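{- For every integer $n\ge 2$, the mixed graph $G(n)$ has diameter at most $2n$.
   Context: A mixed graph has a vertex set, a set of (undirected) edges and a set of arcs. A walk may traverse an edge in either direction and an arc only from tail to head; $\mathrm{dist}(u,v)$ is the length of a shortest walk from $u$ to $v$, and the diameter is the maximum of $\mathrm{dist}(u,v)$ over all ordered pairs of vertices. For $n\ge 2$, write vertices as $x_0|x_1\ldots x_n$ with all $x_i\in\mathbb{Z}_2$, and $\overline{x}=x+1$. The mixed graph $G(n)$ has as vertex set all $2^{n+1}$ such labels except four: $0|00\ldots0$ and $0|11\ldots1$, together with $1|0101\ldots0$ and $1|1010\ldots1$ if $n$ is odd, or $0|0101\ldots01$ and $0|1010\ldots10$ if $n$ is even (so $G(n)$ has $2^{n+1}-4$ vertices). Edges: $1|00\ldots0\sim 1|11\ldots1$; if $n$ is odd, $0|0101\ldots0\sim 0|1010\ldots1$; if $n$ is even, $1|0101\ldots01\sim 1|1010\ldots10$; and for every other vertex, $x_0|x_1\ldots x_n\sim \overline{x_0}|x_1\ldots x_n$. Arcs: $x_0|x_1x_2\ldots x_n\rightarrow x_0|x_2\ldots x_n(x_1+x_0)$ (arithmetic modulo 2). With this definition every vertex is incident with exactly one edge, one outgoing arc and one incoming arc. -}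

module Defs where

open import Data.Bool using (Bool; true; false; not; _xor_; if_then_else_)
open import Data.Nat using (ℕ; zero; suc)
open import Data.Vec using (Vec; []; _∷_; _∷ʳ_; replicate)
open import Data.Product using (_×_; _,_; proj₁; proj₂)
open import Data.Sum using (_⊎_)
open import Data.List using (List; []; _∷_)
open import Data.List.Membership.Propositional using (_∈_)
open import Relation.Nullary using (¬_; Dec; yes; no)
open import Relation.Binary.PropositionalEquality using (_≡_)
import Data.Bool.Properties as BoolP
import Data.Vec.Properties as VecP
import Data.Product.Properties as ProdP

-- A label x₀|x₁…xₙ : the bit x₀ together with the word x₁…xₙ.
Label : ℕ → Set
Label n = Bool × Vec Bool n

_≟L_ : ∀ {n} (u v : Label n) → Dec (u ≡ v)
_≟L_ = ProdP.≡-dec BoolP._≟_ (VecP.≡-dec BoolP._≟_)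

alt : Bool → (n : ℕ) → Vec Bool n
alt b zero    = []
alt b (suc n) = b ∷ alt (not b) n

oddBit : ℕ → Bool
oddBit zero    = false
oddBit (suc n) = not (oddBit n)

zeros ones : (n : ℕ) → Vec Bool n
zeros n = replicate n false
ones  n = replicate n true

excluded : (n : ℕ) → List (Label n)
excluded n = (false , zeros n) ∷ (false , ones n)
           ∷ (oddBit n , alt false n) ∷ (oddBit n , alt true n) ∷ []

IsVertex : (n : ℕ) → Label n → Set
IsVertex n u = ¬ (u ∈ excluded n)

-- The unique edge-neighbour of a vertex:
--   1|00…0 ~ 1|11…1 ;  q|0101… ~ q|1010…  with q = not p ;
--   every other vertex x₀|x ~ x̄₀|x.
partner : (n : ℕ) → Label n → Label n
partner n u with u ≟L (true , zeros n)
... | yes _ = (true , ones n)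
... | no _ with u ≟L (true , ones n)
...   | yes _ = (true , zeros n)
...   | no _ with u ≟L (not (oddBit n) , alt false n)
...     | yes _ = (not (oddBit n) , alt true n)
...     | no _ with u ≟L (not (oddBit n) , alt true n)
...       | yes _ = (not (oddBit n) , alt false n)
...       | no _ = (not (proj₁ u) , proj₂ u)

Edge : (n : ℕ) → Label n → Label n → Set
Edge n u v = v ≡ partner n u

arcHead : ∀ {n} → Label n → Label n
arcHead (b , [])     = (b , [])
arcHead (b , x ∷ xs) = (b , xs ∷ʳ (x xor b))

Step : (n : ℕ) → Label n → Label n → Set
Step n u v = IsVertex n u × IsVertex n v
           × (Edge n u v ⊎ Edge n v u ⊎ v ≡ arcHead u)

data Walk (n : ℕ) : Label n → Label n → ℕ → Set where
  nil  : ∀ {u} → Walk n u u zero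
  cons : ∀ {u v w k} → Step n u v → Walk n v w k → Walk n u w (suc k)

module Submission where

-- Flipping x₀ freely (ignoring the four removed labels), b|w is reached from a|x by
-- shifting w in through n arcs, setting x₀ before the i-th arc to xᵢ + wᵢ; the length is
-- n plus the number of changes along a, x₁ + w₁, …, xₙ + wₙ, b, hence at most 2n + 1.
-- Shifting in an extra bit y before w gives a second walk whose length has the opposite
-- parity (every change count along a, …, b has the parity of a + b); since y enters only
-- the first and last control bits, one of the two choices of y also keeps this walk within
-- 2n + 1 steps. So one of the two walks has length at most 2n. The four removed labels are
-- traps: arcs permute them, and their x₀-flips are vertices of G(n) that coincide or are
-- joined by an edge along each arc orbit, so a walk through them shortcuts to a walk in
-- G(n) that is no longer.

open import Defs
open import Data.Nat using (ℕ; _≤_; _*_)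
open import Data.Product using (∃-syntax; _×_)

open import Data.Bool using (Bool; true; false; not; _xor_)
open import Data.Bool.Properties
  using (not-involutive; not-¬; not-distribˡ-xor; not-distribʳ-xor; xor-assoc; xor-same; xor-identityʳ)
open import Data.Empty using (⊥-elim)
open import Data.List using (_++_)
open import Data.List.Membership.Propositional using (_∈_)
open import Data.List.Properties using (∷-injective; ∷ʳ-++; ++-identityʳ)
open import Data.List.Relation.Unary.Any using (here; there; any?)
open import Data.Nat using (zero; suc; _+_; z≤n; s≤s; _≤?_)
open import Data.Nat.Properties
open import Algebra.Properties.CommutativeSemigroup +-commutativeSemigroup
  using (interchange; x∙yz≈y∙xz)
open import Data.Product using (_,_; proj₁; proj₂)
open import Data.Sum using (_⊎_; inj₁; inj₂; [_,_]′)
open import Data.Vec using (Vec; []; _∷_; _∷ʳ_; replicate; zipWith; toList; initLast)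
open import Data.Vec.Properties using (toList-injective; toList-∷ʳ; cast-is-id; ∷ʳ-injective)
open import Function using (_∘′_)
open import Relation.Binary.PropositionalEquality
open import Relation.Nullary using (yes; no; contradiction)

private
  variable
    k m : ℕ

xor-cancelˡ : ∀ x y → x xor (x xor y) ≡ y
xor-cancelˡ x y = trans (sym (xor-assoc x x y)) (cong (_xor y) (xor-same x))

xor-cancelʳ : ∀ x y → (x xor y) xor y ≡ x
xor-cancelʳ x y = trans (xor-assoc x y y) (trans (cong (x xor_) (xor-same y)) (xor-identityʳ x))

oddBit-+ : ∀ m n → oddBit (m + n) ≡ oddBit m xor oddBit n
oddBit-+ zero    n = refl
oddBit-+ (suc m) n = trans (cong not (oddBit-+ m n)) (not-distribˡ-xor (oddBit m) (oddBit n))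

mismatch : Bool → Bool → ℕ
mismatch false false = 0
mismatch false true  = 1
mismatch true  false = 1
mismatch true  true  = 0

mismatch≤1 : ∀ a b → mismatch a b ≤ 1
mismatch≤1 false false = z≤n
mismatch≤1 false true  = ≤-refl
mismatch≤1 true  false = ≤-refl
mismatch≤1 true  true  = z≤n

mismatch-notʳ : ∀ a b → mismatch a b + mismatch a (not b) ≡ 1
mismatch-notʳ false false = refl
mismatch-notʳ false true  = refl
mismatch-notʳ true  false = refl
mismatch-notʳ true  true  = refl

mismatch-notˡ : ∀ a b → mismatch a b + mismatch (not a) b ≡ 1
mismatch-notˡ false false = refl
mismatch-notˡ false true  = refl
mismatch-notˡ true  false = refl
mismatch-notˡ true  true  = refl

oddBit-mismatch : ∀ a b → oddBit (mismatch a b) ≡ a xor b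
oddBit-mismatch false false = refl
oddBit-mismatch false true  = refl
oddBit-mismatch true  false = refl
oddBit-mismatch true  true  = refl

flips : Bool → Vec Bool k → Bool → ℕ
flips a []      b = mismatch a b
flips a (c ∷ C) b = mismatch a c + flips c C b

flips≤ : ∀ a (C : Vec Bool k) b → flips a C b ≤ suc k
flips≤ a []      b = mismatch≤1 a b
flips≤ a (c ∷ C) b = +-mono-≤ (mismatch≤1 a c) (flips≤ c C b)

oddBit-flips : ∀ a (C : Vec Bool k) b → oddBit (flips a C b) ≡ a xor b
oddBit-flips a []      b = oddBit-mismatch a b
oddBit-flips a (c ∷ C) b = begin
  oddBit (mismatch a c + flips c C b)            ≡⟨ oddBit-+ (mismatch a c) (flips c C b) ⟩
  oddBit (mismatch a c) xor oddBit (flips c C b) ≡⟨ cong₂ _xor_ (oddBit-mismatch a c) (oddBit-flips c C b) ⟩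
  (a xor c) xor (c xor b)                        ≡⟨ xor-assoc a c (c xor b) ⟩
  a xor (c xor (c xor b))                        ≡⟨ cong (a xor_) (xor-cancelˡ c b) ⟩
  a xor b                                        ∎
  where open ≡-Reasoning

flips-toggleLast : ∀ a b d (C : Vec Bool k) →
                   flips a (C ∷ʳ d) b + flips a (C ∷ʳ not d) b ≤ 2 * suc k
flips-toggleLast a b d [] = ≤-reflexive (begin
  (mismatch a d + mismatch d b) + (mismatch a (not d) + mismatch (not d) b)
    ≡⟨ interchange (mismatch a d) _ _ _ ⟩
  (mismatch a d + mismatch a (not d)) + (mismatch d b + mismatch (not d) b)
    ≡⟨ cong₂ _+_ (mismatch-notʳ a d) (mismatch-notˡ d b) ⟩
  2 ∎)
  where open ≡-Reasoning
flips-toggleLast {suc k} a b d (c ∷ C) = begin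
  (mismatch a c + flips c (C ∷ʳ d) b) + (mismatch a c + flips c (C ∷ʳ not d) b)
    ≡⟨ interchange (mismatch a c) _ _ _ ⟩
  (mismatch a c + mismatch a c) + (flips c (C ∷ʳ d) b + flips c (C ∷ʳ not d) b)
    ≤⟨ +-mono-≤ (+-mono-≤ (mismatch≤1 a c) (mismatch≤1 a c)) (flips-toggleLast c b d C) ⟩
  2 + 2 * suc k
    ≡⟨ *-suc 2 (suc k) ⟨
  2 * suc (suc k) ∎
  where open ≤-Reasoning

flips-toggleEnds : ∀ a b c d (E : Vec Bool (suc k)) →
                   flips a (c ∷ (E ∷ʳ d)) b + flips a (not c ∷ (E ∷ʳ not d)) b ≤ 2 * suc (suc k)
flips-toggleEnds {k} a b c d (e ∷ E) = begin
  (mismatch a c + (mismatch c e + F)) + (mismatch a (not c) + (mismatch (not c) e + F′))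
    ≡⟨ interchange (mismatch a c) _ _ _ ⟩
  (mismatch a c + mismatch a (not c)) + ((mismatch c e + F) + (mismatch (not c) e + F′))
    ≡⟨ cong₂ _+_ (mismatch-notʳ a c) (interchange (mismatch c e) _ _ _) ⟩
  1 + ((mismatch c e + mismatch (not c) e) + (F + F′))
    ≡⟨ cong (λ t → 1 + (t + (F + F′))) (mismatch-notˡ c e) ⟩
  2 + (F + F′)
    ≤⟨ +-monoʳ-≤ 2 (flips-toggleLast e b d E) ⟩
  2 + 2 * suc k
    ≡⟨ *-suc 2 (suc k) ⟨
  2 * suc (suc k) ∎
  where
  open ≤-Reasoning
  F  = flips e (E ∷ʳ d) b
  F′ = flips e (E ∷ʳ not d) b

m+n≤2o⇒m≤o⊎n≤o : ∀ {m n o} → m + n ≤ 2 * o → m ≤ o ⊎ n ≤ o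
m+n≤2o⇒m≤o⊎n≤o {m} {n} {o} m+n≤2o with m ≤? o | n ≤? o
... | yes m≤o | _       = inj₁ m≤o
... | no _    | yes n≤o = inj₂ n≤o
... | no m≰o  | no n≰o  = contradiction m+n≤2o (<⇒≱ (begin-strict
  2 * o       ≡⟨ cong (o +_) (+-identityʳ o) ⟩
  o + o       <⟨ +-mono-< (≰⇒> m≰o) (≰⇒> n≰o) ⟩
  m + n       ∎))
  where open ≤-Reasoning

≤⊎≤-byParity : ∀ {m n o} → m ≤ suc o → n ≤ suc o → oddBit n ≡ not (oddBit m) → m ≤ o ⊎ n ≤ o
≤⊎≤-byParity m≤1+o n≤1+o parity with m≤n⇒m<n∨m≡n m≤1+o | m≤n⇒m<n∨m≡n n≤1+o
... | inj₁ (s≤s m≤o) | _              = inj₁ m≤o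
... | inj₂ _         | inj₁ (s≤s n≤o) = inj₂ n≤o
... | inj₂ refl      | inj₂ refl      = contradiction parity (not-¬ refl)

zipWith-∷ʳ : ∀ {A B C : Set} (f : A → B → C) (xs : Vec A k) (ys : Vec B k) x y →
             zipWith f (xs ∷ʳ x) (ys ∷ʳ y) ≡ zipWith f xs ys ∷ʳ f x y
zipWith-∷ʳ f []       []       x y = refl
zipWith-∷ʳ f (a ∷ xs) (b ∷ ys) x y = cong (f a b ∷_) (zipWith-∷ʳ f xs ys x y)

replicate-∷ʳ : ∀ m (x : Bool) → replicate m x ∷ʳ x ≡ replicate (suc m) x
replicate-∷ʳ zero    x = refl
replicate-∷ʳ (suc m) x = cong (x ∷_) (replicate-∷ʳ m x)

alt-∷ʳ : ∀ m c → alt c m ∷ʳ (c xor oddBit m) ≡ alt c (suc m)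
alt-∷ʳ zero    c = cong (_∷ []) (xor-identityʳ c)
alt-∷ʳ (suc m) c = cong (c ∷_) (trans (cong (alt (not c) m ∷ʳ_) (begin
  c xor not (oddBit m) ≡⟨ not-distribʳ-xor c (oddBit m) ⟨
  not (c xor oddBit m) ≡⟨ not-distribˡ-xor c (oddBit m) ⟩
  not c xor oddBit m   ∎)) (alt-∷ʳ m (not c)))
  where open ≡-Reasoning

flip₀ : ∀ {n} → Label n → Label n
flip₀ (b , z) = (not b , z)

flip₀-involutive : ∀ {n} (u : Label n) → flip₀ (flip₀ u) ≡ u
flip₀-involutive (b , z) = cong (_, z) (not-involutive b)

-- Walks in the mixed graph on all 2ⁿ⁺¹ labels whose edges are x₀|x ∼ x̄₀|x.
data FullWalk (n : ℕ) : Label n → Label n → ℕ → Set where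
  []        : ∀ {u} → FullWalk n u u 0
  flip-then : ∀ {u v l} → FullWalk n (flip₀ u) v l → FullWalk n u v (suc l)
  arc-then  : ∀ {u v l} → FullWalk n (arcHead u) v l → FullWalk n u v (suc l)

setHead : ∀ {n z v l} (a c : Bool) → FullWalk n (c , z) v l → FullWalk n (a , z) v (mismatch a c + l)
setHead false false w = w
setHead false true  w = flip-then w
setHead true  false w = flip-then w
setHead true  true  w = w

-- The hypothesis says that P lists the k bits leaving the window while W enters, and
-- w is the final window. Before each arc the head is set to the leaving bit xor the
-- entering bit, so that the arc appends exactly the entering bit.
shiftIn : ∀ (a b : Bool) (z w : Vec Bool (suc m)) (P W : Vec Bool k) →
          toList z ++ toList W ≡ toList P ++ toList w →
          FullWalk (suc m) (a , z) (b , w) (k + flips a (zipWith _xor_ P W) b)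
shiftIn a b z w [] [] tape =
  subst₂ (λ w′ l → FullWalk _ (a , z) (b , w′) l) z≡w (+-identityʳ (mismatch a b)) (setHead a b [])
  where
  z≡w : z ≡ w
  z≡w = trans (sym (cast-is-id refl z))
              (toList-injective refl z w (trans (sym (++-identityʳ (toList z))) tape))
shiftIn {k = suc k} a b (y ∷ ys) w (y′ ∷ P) (t ∷ W) tape with ∷-injective tape
... | refl , tape′ = subst (FullWalk _ _ _) (reorder (mismatch a c) k _) (setHead a c (arc-then rest))
  where
  c = y xor t
  tape″ : toList (ys ∷ʳ t) ++ toList W ≡ toList P ++ toList w
  tape″ = trans (cong (_++ toList W) (toList-∷ʳ t ys)) (trans (∷ʳ-++ (toList ys) t (toList W)) tape′)
  ℓ = k + flips c (zipWith _xor_ P W) b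
  rest : FullWalk _ (arcHead (c , y ∷ ys)) (b , w) ℓ
  rest = subst (λ s → FullWalk _ (c , ys ∷ʳ s) (b , w) ℓ) (sym (xor-cancelˡ y t))
               (shiftIn c b (ys ∷ʳ t) w P W tape″)
  reorder : ∀ d k f → d + suc (k + f) ≡ suc (k + (d + f))
  reorder d k f = trans (+-suc d (k + f)) (cong suc (x∙yz≈y∙xz d k f))

oddBit-+-flips : ∀ n a (C : Vec Bool k) b → oddBit (n + flips a C b) ≡ oddBit n xor (a xor b)
oddBit-+-flips n a C b = trans (oddBit-+ n (flips a C b)) (cong (oddBit n xor_) (oddBit-flips a C b))

extraBit-flips≤ : ∀ a b (x w : Vec Bool (suc (suc k))) →
                  ∃[ y ] (flips a (zipWith _xor_ (x ∷ʳ y) (y ∷ w)) b ≤ suc (suc k))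
extraBit-flips≤ {k} a b (x₁ ∷ xs) w with initLast w
... | ws , wₙ , refl = [ withBit false , withBit true ]′ (m+n≤2o⇒m≤o⊎n≤o cost-sum)
  where
  E = zipWith _xor_ xs ws
  cost : Bool → ℕ
  cost y = flips a ((x₁ xor y) ∷ (E ∷ʳ (y xor wₙ))) b
  cost-sum : cost false + cost true ≤ 2 * suc (suc k)
  cost-sum = subst (λ c → cost false + flips a (c ∷ (E ∷ʳ not wₙ)) b ≤ 2 * suc (suc k))
               (not-distribʳ-xor x₁ false) (flips-toggleEnds a b (x₁ xor false) wₙ E)
  withBit : ∀ y → cost y ≤ suc (suc k) →
            ∃[ y′ ] (flips a (zipWith _xor_ ((x₁ ∷ xs) ∷ʳ y′) (y′ ∷ (ws ∷ʳ wₙ))) b ≤ suc (suc k))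
  withBit y cost≤ = y , subst (λ T → flips a ((x₁ xor y) ∷ T) b ≤ suc (suc k))
                              (sym (zipWith-∷ʳ _xor_ xs ws y wₙ)) cost≤

fullWalk≤2n : ∀ a b (x w : Vec Bool (suc (suc k))) →
              ∃[ l ] (l ≤ 2 * suc (suc k) × FullWalk (suc (suc k)) (a , x) (b , w) l)
fullWalk≤2n {k} a b x w = choose (extraBit-flips≤ a b x w)
  where
  n = suc (suc k)
  n+n≡2n : n + n ≡ 2 * n
  n+n≡2n = cong (n +_) (sym (+-identityʳ n))
  direct : FullWalk n (a , x) (b , w) (n + flips a (zipWith _xor_ x w) b)
  direct = shiftIn a b x w x w refl
  viaExtra : ∀ y → FullWalk n (a , x) (b , w) (suc n + flips a (zipWith _xor_ (x ∷ʳ y) (y ∷ w)) b)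
  viaExtra y = shiftIn a b x w (x ∷ʳ y) (y ∷ w)
    (sym (trans (cong (_++ toList w) (toList-∷ʳ y x)) (∷ʳ-++ (toList x) y (toList w))))
  direct≤ : n + flips a (zipWith _xor_ x w) b ≤ suc (n + n)
  direct≤ = ≤-trans (+-monoʳ-≤ n (flips≤ a (zipWith _xor_ x w) b)) (≤-reflexive (+-suc n n))
  opposite-parity : ∀ y → oddBit (suc n + flips a (zipWith _xor_ (x ∷ʳ y) (y ∷ w)) b)
                           ≡ not (oddBit (n + flips a (zipWith _xor_ x w) b))
  opposite-parity y = cong not (trans (oddBit-+-flips n a (zipWith _xor_ (x ∷ʳ y) (y ∷ w)) b)
                                      (sym (oddBit-+-flips n a (zipWith _xor_ x w) b)))
  choose : ∃[ y ] (flips a (zipWith _xor_ (x ∷ʳ y) (y ∷ w)) b ≤ n) →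
           ∃[ l ] (l ≤ 2 * n × FullWalk n (a , x) (b , w) l)
  choose (y , extra≤) with ≤⊎≤-byParity direct≤ (s≤s (+-monoʳ-≤ n extra≤)) (opposite-parity y)
  ... | inj₁ ≤n+n = _ , ≤-trans ≤n+n (≤-reflexive n+n≡2n) , direct
  ... | inj₂ ≤n+n = _ , ≤-trans ≤n+n (≤-reflexive n+n≡2n) , viaExtra y

arcHead-replicate : ∀ n x → arcHead (false , replicate n x) ≡ (false , replicate n x)
arcHead-replicate zero    x = refl
arcHead-replicate (suc n) x =
  cong (false ,_) (trans (cong (replicate n x ∷ʳ_) (xor-identityʳ x)) (replicate-∷ʳ n x))

arcHead-alt : ∀ n c → arcHead (oddBit n , alt c n) ≡ (oddBit n , alt (not c) n)
arcHead-alt zero    c = refl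
arcHead-alt (suc n) c = cong (oddBit (suc n) ,_) (begin
  alt (not c) n ∷ʳ (c xor not (oddBit n)) ≡⟨ cong (alt (not c) n ∷ʳ_) (not-distribʳ-xor c (oddBit n)) ⟨
  alt (not c) n ∷ʳ not (c xor oddBit n)   ≡⟨ cong (alt (not c) n ∷ʳ_) (not-distribˡ-xor c (oddBit n)) ⟩
  alt (not c) n ∷ʳ (not c xor oddBit n)   ≡⟨ alt-∷ʳ n (not c) ⟩
  alt (not c) (suc n)                     ∎)
  where open ≡-Reasoning

arcHead-injective : ∀ {n} {u v : Label n} → arcHead u ≡ arcHead v → u ≡ v
arcHead-injective {u = b , []}     {v = b′ , []}       eq = eq
arcHead-injective {u = b , y ∷ ys} {v = b′ , y′ ∷ ys′} eq with cong proj₁ eq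
... | refl with ∷ʳ-injective ys ys′ (cong proj₂ eq)
...   | refl , last≡ = cong (λ y → b , y ∷ ys)
          (trans (sym (xor-cancelʳ y b)) (trans (cong (_xor b) last≡) (xor-cancelʳ y′ b)))

arcHead-excluded : ∀ {n e} → e ∈ excluded n → arcHead e ∈ excluded n
arcHead-excluded {n} (here refl)                       = here (arcHead-replicate n false)
arcHead-excluded {n} (there (here refl))               = there (here (arcHead-replicate n true))
arcHead-excluded {n} (there (there (here refl)))       = there (there (there (here (arcHead-alt n false))))
arcHead-excluded {n} (there (there (there (here refl)))) = there (there (here (arcHead-alt n true)))

arcHead-excluded⁻¹ : ∀ {n u} → arcHead u ∈ excluded n → u ∈ excluded n
arcHead-excluded⁻¹ {n} (here eq) =
  here (arcHead-injective (trans eq (sym (arcHead-replicate n false))))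
arcHead-excluded⁻¹ {n} (there (here eq)) =
  there (here (arcHead-injective (trans eq (sym (arcHead-replicate n true)))))
arcHead-excluded⁻¹ {n} (there (there (here eq))) =
  there (there (there (here (arcHead-injective (trans eq (sym (arcHead-alt n true)))))))
arcHead-excluded⁻¹ {n} (there (there (there (here eq)))) =
  there (there (here (arcHead-injective (trans eq (sym (arcHead-alt n false))))))

arcHead-vertex : ∀ {n u} → IsVertex n u → IsVertex n (arcHead u)
arcHead-vertex u-vertex = u-vertex ∘′ arcHead-excluded⁻¹

WalkWithin : (n : ℕ) → Label n → Label n → ℕ → Set
WalkWithin n u v m = ∃[ l ] (l ≤ m × Walk n u v l)

_◅_ : ∀ {n u v w m} → Step n u v → WalkWithin n v w m → WalkWithin n u w (suc m)
step ◅ (l , l≤m , walk) = suc l , s≤s l≤m , cons step walk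

within-mono : ∀ {n u v m m′} → m ≤ m′ → WalkWithin n u v m → WalkWithin n u v m′
within-mono m≤m′ (l , l≤m , walk) = l , ≤-trans l≤m m≤m′ , walk

within-suc : ∀ {n u v m} → WalkWithin n u v m → WalkWithin n u v (suc m)
within-suc = within-mono (n≤1+n _)

partner-flip₀ : ∀ {n} (u : Label n) → IsVertex n (flip₀ u) → partner n u ≡ flip₀ u
partner-flip₀ {n} u flip-vertex with u ≟L (true , zeros n)
... | yes refl = ⊥-elim (flip-vertex (here refl))
... | no _ with u ≟L (true , ones n)
...   | yes refl = ⊥-elim (flip-vertex (there (here refl)))
...   | no _ with u ≟L (not (oddBit n) , alt false n)
...     | yes refl = ⊥-elim (flip-vertex (there (there (here (cong (_, alt false n) (not-involutive _))))))
...     | no _ with u ≟L (not (oddBit n) , alt true n)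
...       | yes refl = ⊥-elim (flip-vertex (there (there (there (here (cong (_, alt true n) (not-involutive _)))))))
...       | no _ = refl

module _ (k : ℕ) where

  private
    n = suc (suc k)
    q = not (oddBit n)

  partner-alt : ∀ c → partner n (q , alt c n) ≡ (q , alt (not c) n)
  partner-alt false with (q , alt false n) ≟L (true , zeros n)
  ... | yes ()
  ... | no _ with (q , alt false n) ≟L (true , ones n)
  ...   | yes ()
  ...   | no _ with (q , alt false n) ≟L (q , alt false n)
  ...     | yes _  = refl
  ...     | no ≢refl = ⊥-elim (≢refl refl)
  partner-alt true with (q , alt true n) ≟L (true , zeros n)
  ... | yes ()
  ... | no _ with (q , alt true n) ≟L (true , ones n)
  ...   | yes ()
  ...   | no _ with (q , alt true n) ≟L (q , alt false n)
  ...     | yes ()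
  ...     | no _ with (q , alt true n) ≟L (q , alt true n)
  ...       | yes _  = refl
  ...       | no ≢refl = ⊥-elim (≢refl refl)

  alt-vertex : ∀ c → IsVertex n (q , alt c n)
  alt-vertex c     (here ())
  alt-vertex c     (there (here ()))
  alt-vertex false (there (there (here eq)))         = not-¬ refl (sym (cong proj₁ eq))
  alt-vertex true  (there (there (here ())))
  alt-vertex false (there (there (there (here ()))))
  alt-vertex true  (there (there (there (here eq)))) = not-¬ refl (sym (cong proj₁ eq))

  flip₀-excluded-vertex : ∀ {e} → e ∈ excluded n → IsVertex n (flip₀ e)
  flip₀-excluded-vertex (here refl) =
    λ { (here ()) ; (there (here ())) ; (there (there (here ()))) ; (there (there (there (here ())))) }
  flip₀-excluded-vertex (there (here refl)) =
    λ { (here ()) ; (there (here ())) ; (there (there (here ()))) ; (there (there (there (here ())))) }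
  flip₀-excluded-vertex (there (there (here refl)))         = alt-vertex false
  flip₀-excluded-vertex (there (there (there (here refl)))) = alt-vertex true

  alt-step : ∀ c → Step n (q , alt c n) (q , alt (not c) n)
  alt-step c = alt-vertex c , alt-vertex (not c) , inj₁ (sym (partner-alt c))

  excluded-arcHead-step : ∀ {e} → e ∈ excluded n →
                          flip₀ (arcHead e) ≡ flip₀ e ⊎ Step n (flip₀ e) (flip₀ (arcHead e))
  excluded-arcHead-step (here refl)               = inj₁ (cong flip₀ (arcHead-replicate n false))
  excluded-arcHead-step (there (here refl))       = inj₁ (cong flip₀ (arcHead-replicate n true))
  excluded-arcHead-step (there (there (here refl))) =
    inj₂ (subst (Step n _) (cong flip₀ (sym (arcHead-alt n false))) (alt-step false))
  excluded-arcHead-step (there (there (there (here refl)))) =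
    inj₂ (subst (Step n _) (cong flip₀ (sym (arcHead-alt n true))) (alt-step true))

  mutual
    toWalk : ∀ {u v l} → IsVertex n u → IsVertex n v → FullWalk n u v l → WalkWithin n u v l
    toWalk _ _ [] = 0 , z≤n , nil
    toWalk u-vertex v-vertex (arc-then walk) =
      (u-vertex , arcHead-vertex u-vertex , inj₂ (inj₂ refl)) ◅ toWalk (arcHead-vertex u-vertex) v-vertex walk
    toWalk {u} u-vertex v-vertex (flip-then walk) with any? (flip₀ u ≟L_) (excluded n)
    ... | no flip-vertex =
      (u-vertex , flip-vertex , inj₁ (sym (partner-flip₀ u flip-vertex))) ◅ toWalk flip-vertex v-vertex walk
    ... | yes flip-excluded =
      within-suc (subst (λ s → WalkWithin n s _ _) (flip₀-involutive u) (escape flip-excluded v-vertex walk))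

    escape : ∀ {e v l} → e ∈ excluded n → IsVertex n v → FullWalk n e v l → WalkWithin n (flip₀ e) v l
    escape e-excluded v-vertex [] = ⊥-elim (v-vertex e-excluded)
    escape e-excluded v-vertex (flip-then walk) =
      within-suc (toWalk (flip₀-excluded-vertex e-excluded) v-vertex walk)
    escape e-excluded v-vertex (arc-then walk)
      with excluded-arcHead-step e-excluded | escape (arcHead-excluded e-excluded) v-vertex walk
    ... | inj₁ same | rest = within-suc (subst (λ s → WalkWithin n s _ _) same rest)
    ... | inj₂ step | rest = step ◅ rest

mainTheorem3 : (n : ℕ) → 2 ≤ n →
    (u v : Label n) → IsVertex n u → IsVertex n v →
    ∃[ k ] (k ≤ 2 * n × Walk n u v k)
mainTheorem3 (suc (suc k)) (s≤s (s≤s z≤n)) (a , x) (b , w) u-vertex v-vertex =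
  let l , l≤2n , walk = fullWalk≤2n a b x w
  in within-mono l≤2n (toWalk k u-vertex v-vertex walk)
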